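{- Let $G$ be a graph with vertex set $\{v_1,\dots,v_k\}$, let $M_i=(V_i,E_i)$, $1\le i\le k$, be pairwise vertex-disjoint graphs, and let $H$ be the graph obtained from $G$ by expanding each $v_i$ by the module $M_i$. Let $\Omega$ be a potential maximal clique of $H$ and suppose some $V_i$ intersects $\Omega$ but is not contained in $\Omega$. Then $\Omega\cap V_i$ is a potential maximal clique of $M_i$ and $\Omega\setminus V_i=N_H(V_i)$.
   Context: The expansion $H$ has vertex set $V_1\cup\dots\cup V_k$ and edge set $E_1\cup\dots\cup E_k\cup\{ab\mid a\in V_i,\ b\in V_j,\ v_iv_j\in E(G)\}$. $N_H(A)=\bigcup_{v\in A}N_H(v)\setminus A$. A chordal graph is one where every cycle of length at least four has a chord; a minimal triangulation of a graph $(V,E)$ is a chordal graph $(V,E')$ with $E\subseteq E'$ such that no $(V,E'')$ with $E\subseteq E''\subsetneq E'$ is chordal. A potential maximal clique of a graph is a vertex set that is a maximal clique of some minimal triangulation of that graph. -}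

module Defs where

open import Data.Nat using (ℕ; zero; suc; _≤_; _∸_)
open import Data.Fin as Fin using (Fin; toℕ)
open import Data.Bool using (Bool; true; false)
open import Data.Product using (Σ; ∃; _×_; _,_; proj₁; proj₂)
open import Data.Sum using (_⊎_)
open import Data.Empty using (⊥-elim)
open import Level using (0ℓ)
open import Relation.Nullary using (¬_; yes; no)
open import Relation.Unary using (Pred; _⊆_)
open import Relation.Binary.PropositionalEquality using (_≡_; _≢_; refl)
open import Function.Definitions using (Injective)

record SimpleGraph (V : Set) : Set where
  field
    adj    : V → V → Bool
    adj-sym : ∀ x y → adj x y ≡ adj y x
    irrefl : ∀ x → adj x x ≡ false
open SimpleGraph public

Edge : {V : Set} → SimpleGraph V → V → V → Set
Edge G x y = adj G x y ≡ true

_⊑_ : {V : Set} → SimpleGraph V → SimpleGraph V → Set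
G ⊑ T = ∀ x y → Edge G x y → Edge T x y

CycNext : (l : ℕ) → Fin l → Fin l → Set
CycNext l i j = (toℕ j ≡ suc (toℕ i)) ⊎ ((toℕ i ≡ l ∸ 1) × (toℕ j ≡ 0))

IsCycle : {V : Set} → SimpleGraph V → (l : ℕ) → (Fin l → V) → Set
IsCycle G l c = Injective _≡_ _≡_ c × (∀ i j → CycNext l i j → Edge G (c i) (c j))

HasChord : {V : Set} → SimpleGraph V → (l : ℕ) → (Fin l → V) → Set
HasChord G l c = Σ (Fin l) λ i → Σ (Fin l) λ j →
  i ≢ j × ¬ CycNext l i j × ¬ CycNext l j i × Edge G (c i) (c j)

Chordal : {V : Set} → SimpleGraph V → Set
Chordal {V} G = ∀ (l : ℕ) → 4 ≤ l → (c : Fin l → V) → IsCycle G l c → HasChord G l c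

MinimalTriangulation : {V : Set} → SimpleGraph V → SimpleGraph V → Set
MinimalTriangulation {V} G T =
  G ⊑ T × Chordal T ×
  (∀ (T' : SimpleGraph V) → G ⊑ T' → T' ⊑ T → Chordal T' → T ⊑ T')

IsClique : {V : Set} → SimpleGraph V → Pred V 0ℓ → Set
IsClique G Ω = ∀ x y → Ω x → Ω y → x ≢ y → Edge G x y

IsMaximalClique : {V : Set} → SimpleGraph V → Pred V 0ℓ → Set₁
IsMaximalClique {V} G Ω =
  IsClique G Ω × (∀ (Ω' : Pred V 0ℓ) → IsClique G Ω' → Ω ⊆ Ω' → Ω' ⊆ Ω)

IsPMC : {V : Set} → SimpleGraph V → Pred V 0ℓ → Set₁
IsPMC {V} G Ω = Σ (SimpleGraph V) λ T → MinimalTriangulation G T × IsMaximalClique T Ω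

-- Expansion of G (vertices Fin k) by modules M i (vertices Fin (m i)).
-- Vertex set of H: the disjoint union of the V_i, as Σ (Fin k) (Fin ∘ m).
ExpVertex : (k : ℕ) → (Fin k → ℕ) → Set
ExpVertex k m = Σ (Fin k) λ i → Fin (m i)

expAdj : {k : ℕ} {m : Fin k → ℕ} → SimpleGraph (Fin k) → ((i : Fin k) → SimpleGraph (Fin (m i)))
       → ExpVertex k m → ExpVertex k m → Bool
expAdj G M (i , a) (j , b) with i Fin.≟ j
... | yes refl = adj (M i) a b
... | no _     = adj G i j

expSym : {k : ℕ} {m : Fin k → ℕ} (G : SimpleGraph (Fin k)) (M : (i : Fin k) → SimpleGraph (Fin (m i)))
       → ∀ x y → expAdj G M x y ≡ expAdj G M y x
expSym G M (i , a) (j , b) with i Fin.≟ j | j Fin.≟ i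
... | yes refl | yes refl = adj-sym (M i) a b
... | yes refl | no ne = ⊥-elim (ne refl)
... | no ne | yes refl = ⊥-elim (ne refl)
... | no _ | no _ = adj-sym G i j

expIrrefl : {k : ℕ} {m : Fin k → ℕ} (G : SimpleGraph (Fin k)) (M : (i : Fin k) → SimpleGraph (Fin (m i)))
          → ∀ x → expAdj G M x x ≡ false
expIrrefl G M (i , a) with i Fin.≟ i
... | yes refl = irrefl (M i) a
... | no ne = ⊥-elim (ne refl)

Expansion : {k : ℕ} {m : Fin k → ℕ} → SimpleGraph (Fin k) → ((i : Fin k) → SimpleGraph (Fin (m i)))
          → SimpleGraph (ExpVertex k m)
Expansion G M = record { adj = expAdj G M ; adj-sym = expSym G M ; irrefl = expIrrefl G M }

Nbhd : {V : Set} → SimpleGraph V → Pred V 0ℓ → Pred V 0ℓ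
Nbhd {V} H A w = (∃ λ v → A v × Edge H v w) × ¬ A w

Module : {k : ℕ} {m : Fin k → ℕ} → Fin k → Pred (ExpVertex k m) 0ℓ
Module i w = proj₁ w ≡ i

module Submission where

-- Let T be a minimal triangulation of H with Ω a maximal clique of T, write V for V_i,
-- N for N_H(V) (the vertices outside V whose index is adjacent to i in G), and R for the
-- remaining vertices, so that V is complete to N and anticomplete to R in H.  Minimality of T
-- gives three facts.  (1) If V is a clique of T, every vertex outside V is adjacent in T to all
-- of V or to none of it: otherwise deleting the partial edges leaves a chordal graph, because a
-- chordless cycle of it passes through V exactly once, and replacing that vertex by any vertex
-- of V gives a cycle of T all of whose chords meet the new vertex, which is then adjacent to the
-- whole cycle.  (2) If V is not a clique then N is one, as a non-edge in each would span a
-- chordless square.  (3) If N is a clique, T has no edge between V and R: deleting such edges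
-- keeps T chordal, N being a clique separator between V and R.
-- Since Ω meets V without containing it, (1) and maximality of Ω show that V is not a clique, so
-- N is a clique and T has no V–R edge; hence Ω ∖ V ⊆ N, and N ⊆ Ω by maximality.  Finally T
-- restricted to V is a minimal triangulation of M_i: a chordal S between M_i and it can be glued
-- to T along the clique separator N, and minimality of T forces S to be everything; a larger
-- clique of this restriction containing Ω ∩ V would give, together with Ω ∖ V ⊆ N, a larger
-- clique of T.

open import Defs
open import Data.Bool using (Bool; true; false; _∧_)
import Data.Bool as Bool
open import Data.Empty using (⊥; ⊥-elim)
open import Data.Fin as Fin using (Fin; zero; suc; toℕ; fromℕ; inject₁)
open import Data.Fin.Induction using (<-weakInduction; <-weakInduction-startingFrom)
open import Data.Fin.Properties
  using ( suc-injective; toℕ-injective; toℕ<n; toℕ≤pred[n]; toℕ-fromℕ; toℕ-fromℕ<; toℕ-inject₁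
        ; ≤fromℕ; any?; all?)
open import Data.Fin.Relation.Unary.Top using (view; ‵fromℕ; ‵inject₁; view-fromℕ; view-inject₁)
open import Data.Nat as ℕ using (ℕ; zero; suc; _+_; _≤_; _<_; z≤n; s≤s)
open import Data.Nat.GeneralisedArithmetic using (fold)
open import Data.Nat.Induction using (<-rec)
import Data.Nat.Properties as ℕ
open import Data.Product using (∃; _×_; _,_; proj₁; proj₂)
open import Data.Sum as Sum using (_⊎_; inj₁; inj₂)
open import Data.Vec.Functional using ([]; _∷_)
open import Function using (_∘_)
open import Function.Bundles using (mk⇔)
open import Function.Definitions using (Injective)
open import Level using (0ℓ)
open import Relation.Binary.PropositionalEquality
open import Relation.Nullary using (¬_; Dec; yes; no)
open import Relation.Nullary.Decidable
  using (map′; does; does-⇔; toWitness; decidable-stable; _×-dec_; _⊎-dec_; _→-dec_; ¬?)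
open import Relation.Unary using (Pred; _⊆_; _≐_; ∁; Decidable)
open import Relation.Unary.Properties using (≐-sym; ≐-trans)

-- The cyclic order of Fin

next : ∀ {n} → Fin (suc n) → Fin (suc n)
next i with view i
... | ‵fromℕ     = zero
... | ‵inject₁ j = suc j

next-fromℕ : ∀ n → next (fromℕ n) ≡ zero
next-fromℕ n rewrite view-fromℕ n = refl

next-inject₁ : ∀ {n} (i : Fin n) → next (inject₁ i) ≡ suc i
next-inject₁ i rewrite view-inject₁ i = refl

next-injective : ∀ {n} → Injective _≡_ _≡_ (next {n})
next-injective {x = i} {j} eq with view i | view j
... | ‵fromℕ      | ‵fromℕ      = refl
... | ‵fromℕ      | ‵inject₁ _  with () ← eq
... | ‵inject₁ _  | ‵fromℕ      with () ← eq
... | ‵inject₁ _  | ‵inject₁ _  = cong inject₁ (suc-injective eq)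

cycNext-next : ∀ {n} (i : Fin (suc n)) → CycNext (suc n) i (next i)
cycNext-next i with view i
... | ‵fromℕ     = inj₂ (toℕ-fromℕ _ , refl)
... | ‵inject₁ j = inj₁ (cong suc (sym (toℕ-inject₁ j)))

cycNext-functional : ∀ {n} {i j j′ : Fin (suc n)} →
                     CycNext (suc n) i j → CycNext (suc n) i j′ → j ≡ j′
cycNext-functional (inj₁ p) (inj₁ q) = toℕ-injective (trans p (sym q))
cycNext-functional {j = j} (inj₁ p) (inj₂ (q , _)) =
  ⊥-elim (ℕ.<-irrefl (trans p (cong suc q)) (toℕ<n j))
cycNext-functional {j′ = j′} (inj₂ (p , _)) (inj₁ q) =
  ⊥-elim (ℕ.<-irrefl (trans q (cong suc p)) (toℕ<n j′))
cycNext-functional (inj₂ (_ , p)) (inj₂ (_ , q)) = toℕ-injective (trans p (sym q))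

cycNext⇒≡next : ∀ {n} {i j : Fin (suc n)} → CycNext (suc n) i j → j ≡ next i
cycNext⇒≡next {i = i} cn = cycNext-functional cn (cycNext-next i)

≡next⇒cycNext : ∀ {n} {i j : Fin (suc n)} → j ≡ next i → CycNext (suc n) i j
≡next⇒cycNext {i = i} refl = cycNext-next i

cycNext? : ∀ {n} (i j : Fin (suc n)) → Dec (CycNext (suc n) i j)
cycNext? i j = map′ ≡next⇒cycNext cycNext⇒≡next (j Fin.≟ next i)

toℕ-next : ∀ {n} (i : Fin (suc n)) → toℕ i < n → toℕ (next i) ≡ suc (toℕ i)
toℕ-next i i<n with cycNext-next i
... | inj₁ p       = p
... | inj₂ (p , _) = ⊥-elim (ℕ.<-irrefl p i<n)

next-closed⇒universal : ∀ {n} (P : Pred (Fin (suc n)) 0ℓ) → (∀ i → P i → P (next i)) →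
                        ∀ {s} → P s → ∀ j → P j
next-closed⇒universal {n} P step {s} Ps = <-weakInduction P P-zero step′
  where
  step′ : ∀ i → P (inject₁ i) → P (suc i)
  step′ i = subst P (next-inject₁ i) ∘ step (inject₁ i)
  P-zero : P zero
  P-zero = subst P (next-fromℕ n) (step _ (<-weakInduction-startingFrom P Ps step′ (≤fromℕ s)))

exit-point : ∀ {n} {P : Pred (Fin (suc n)) 0ℓ} → Decidable P → ∀ {s t} → P s → ¬ P t →
             ∃ λ u → P u × ¬ P (next u)
exit-point {P = P} P? Ps ¬Pt with any? (λ u → P? u ×-dec ¬? (P? (next u)))
... | yes found = found
... | no none   = ⊥-elim (¬Pt (next-closed⇒universal P closed Ps _))
  where
  closed : ∀ i → P i → P (next i)
  closed i Pi = decidable-stable (P? (next i)) (λ ¬P → none (i , Pi , ¬P))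

rotate : ∀ {n} → Fin (suc n) → Fin (suc n) → Fin (suc n)
rotate s i = fold i next (toℕ s)

fold-next-comm : ∀ {n} k (i : Fin (suc n)) → fold (next i) next k ≡ next (fold i next k)
fold-next-comm zero    i = refl
fold-next-comm (suc k) i = cong next (fold-next-comm k i)

rotate-injective : ∀ {n} (s : Fin (suc n)) → Injective _≡_ _≡_ (rotate s)
rotate-injective s = go (toℕ s)
  where
  go : ∀ k {i j} → fold i next k ≡ fold j next k → i ≡ j
  go zero    eq = eq
  go (suc k) eq = go k (next-injective eq)

toℕ-fold-next-zero : ∀ {n} k → k ≤ n → toℕ (fold (zero {n}) next k) ≡ k
toℕ-fold-next-zero zero    _   = refl
toℕ-fold-next-zero (suc k) k<n = trans (toℕ-next _ (subst (_< _) (sym ih) k<n)) (cong suc ih)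
  where
  ih : toℕ (fold zero next k) ≡ k
  ih = toℕ-fold-next-zero k (ℕ.<⇒≤ k<n)

rotate-zero : ∀ {n} (s : Fin (suc n)) → rotate s zero ≡ s
rotate-zero s = toℕ-injective (toℕ-fold-next-zero (toℕ s) (toℕ≤pred[n] s))

rotate-next : ∀ {n} (s : Fin (suc n)) i → rotate s (next i) ≡ next (rotate s i)
rotate-next s = fold-next-comm (toℕ s)

cycNext-rotate : ∀ {n} (s : Fin (suc n)) {i j} →
                 CycNext (suc n) i j → CycNext (suc n) (rotate s i) (rotate s j)
cycNext-rotate s cn = ≡next⇒cycNext (trans (cong (rotate s) (cycNext⇒≡next cn)) (rotate-next s _))

cycNext-rotate⁻ : ∀ {n} (s : Fin (suc n)) {i j} →
                  CycNext (suc n) (rotate s i) (rotate s j) → CycNext (suc n) i j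
cycNext-rotate⁻ s cn =
  ≡next⇒cycNext (rotate-injective s (trans (cycNext⇒≡next cn) (sym (rotate-next s _))))

nonadjacent-zero : ∀ {n} {j : Fin (suc n)} → 1 < toℕ j → toℕ j < n →
                   ¬ CycNext (suc n) zero j × ¬ CycNext (suc n) j zero
nonadjacent-zero {j = j} 1<j j<n = zero↛j , j↛zero
  where
  zero↛j : ¬ CycNext _ zero j
  zero↛j (inj₁ eq)       = ℕ.<-irrefl (sym eq) 1<j
  zero↛j (inj₂ (eq , _)) = ℕ.n≮0 (subst (toℕ j <_) (sym eq) j<n)
  j↛zero : ¬ CycNext _ j zero
  j↛zero (inj₁ ())
  j↛zero (inj₂ (eq , _)) = ℕ.<-irrefl eq j<n

C₄-pairs : ∀ (i j : Fin 4) → i ≡ j ⊎ CycNext 4 i j ⊎ CycNext 4 j i ⊎ j ≡ next (next i)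
C₄-pairs = toWitness {a? = all? λ i → all? λ j →
  i Fin.≟ j ⊎-dec cycNext? i j ⊎-dec cycNext? j i ⊎-dec j Fin.≟ next (next i)} _

clamp : ∀ {n} → ℕ → Fin (suc n)
clamp {n} k = Fin.fromℕ< (s≤s (ℕ.m⊓n≤n k n))

toℕ-clamp : ∀ {n k} → k ≤ n → toℕ (clamp {n} k) ≡ k
toℕ-clamp {n} {k} k≤n = trans (toℕ-fromℕ< _) (ℕ.m≤n⇒m⊓n≡m k≤n)

-- Cycles and chords

module _ {V : Set} (X : SimpleGraph V) where

  Edge-sym : ∀ {u v} → Edge X u v → Edge X v u
  Edge-sym {u} {v} e = trans (adj-sym X v u) e

  Edge? : ∀ u v → Dec (Edge X u v)
  Edge? u v = adj X u v Bool.≟ true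

  Edge⇒≢ : ∀ {u v} → Edge X u v → u ≢ v
  Edge⇒≢ {u} e refl with () ← trans (sym e) (irrefl X u)

  HasChord? : ∀ {n} (c : Fin (suc n) → V) → Dec (HasChord X (suc n) c)
  HasChord? c = any? λ i → any? λ j →
    ¬? (i Fin.≟ j) ×-dec ¬? (cycNext? i j) ×-dec ¬? (cycNext? j i) ×-dec Edge? (c i) (c j)

  no-chordless⇒chordal : (∀ {n} (c : Fin (4 + n) → V) → IsCycle X (4 + n) c → ¬ HasChord X (4 + n) c → ⊥) →
                         Chordal X
  no-chordless⇒chordal no-chordless (suc (suc (suc (suc n)))) (s≤s (s≤s (s≤s (s≤s _)))) c cyc
    with HasChord? c
  ... | yes chord = chord
  ... | no ¬chord = ⊥-elim (no-chordless c cyc ¬chord)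

  ChordalOn : Pred V 0ℓ → Set
  ChordalOn P = ∀ l → 4 ≤ l → (c : Fin l → V) → IsCycle X l c → (∀ t → P (c t)) → HasChord X l c

  IsCycle-rotate : ∀ {n} (s : Fin (suc n)) {c} → IsCycle X (suc n) c → IsCycle X (suc n) (c ∘ rotate s)
  IsCycle-rotate s (c-injective , c-edge) =
    rotate-injective s ∘ c-injective , λ i j → c-edge _ _ ∘ cycNext-rotate s

  HasChord-rotate⁻ : ∀ {n} (s : Fin (suc n)) {c} → HasChord X (suc n) (c ∘ rotate s) → HasChord X (suc n) c
  HasChord-rotate⁻ s (i , j , i≢j , ¬ij , ¬ji , e) =
    rotate s i , rotate s j , i≢j ∘ rotate-injective s ,
    ¬ij ∘ cycNext-rotate⁻ s , ¬ji ∘ cycNext-rotate⁻ s , e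

  universal⇒HasChord : ∀ {l} {c : Fin l → V} → 4 ≤ l → IsCycle X l c → (s : Fin l) →
                       (∀ t → t ≢ s → Edge X (c s) (c t)) → HasChord X l c
  universal⇒HasChord {suc (suc (suc (suc _)))} {c} (s≤s (s≤s (s≤s (s≤s _)))) cyc s universal =
    HasChord-rotate⁻ s
      ( zero , two , (λ ()) , (λ { (inj₁ ()) ; (inj₂ (() , _)) }) , (λ { (inj₁ ()) ; (inj₂ (() , _)) })
      , subst (λ z → Edge X (c z) (c (rotate s two))) (sym (rotate-zero s))
          (universal _ (λ eq → two≢zero (rotate-injective s (trans eq (sym (rotate-zero s)))))))
    where
    two : Fin _
    two = suc (suc zero)
    two≢zero : two ≢ zero
    two≢zero ()

  chordal-square : Chordal X → ∀ {x₀ x₁ x₂ x₃} → x₀ ≢ x₂ → x₁ ≢ x₃ →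
                   Edge X x₀ x₁ → Edge X x₁ x₂ → Edge X x₂ x₃ → Edge X x₃ x₀ →
                   Edge X x₀ x₂ ⊎ Edge X x₁ x₃
  chordal-square chordal {x₀} {x₁} {x₂} {x₃} x₀≢x₂ x₁≢x₃ e₀₁ e₁₂ e₂₃ e₃₀ =
    diagonal (chordal 4 ℕ.≤-refl c (c-injective , c-edge))
    where
    c : Fin 4 → V
    c = x₀ ∷ x₁ ∷ x₂ ∷ x₃ ∷ []
    c-step : ∀ i → Edge X (c i) (c (next i))
    c-step zero                   = e₀₁
    c-step (suc zero)             = e₁₂
    c-step (suc (suc zero))       = e₂₃
    c-step (suc (suc (suc zero))) = e₃₀
    c-edge : ∀ i j → CycNext 4 i j → Edge X (c i) (c j)
    c-edge i j cn = subst (Edge X (c i) ∘ c) (sym (cycNext⇒≡next cn)) (c-step i)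
    c-opposite : ∀ i → c i ≢ c (next (next i))
    c-opposite zero                   = x₀≢x₂
    c-opposite (suc zero)             = x₁≢x₃
    c-opposite (suc (suc zero))       = x₀≢x₂ ∘ sym
    c-opposite (suc (suc (suc zero))) = x₁≢x₃ ∘ sym
    c-injective : Injective _≡_ _≡_ c
    c-injective {i} {j} eq with C₄-pairs i j
    ... | inj₁ i≡j                = i≡j
    ... | inj₂ (inj₁ cn)          = ⊥-elim (Edge⇒≢ (c-edge i j cn) eq)
    ... | inj₂ (inj₂ (inj₁ cn))   = ⊥-elim (Edge⇒≢ (c-edge j i cn) (sym eq))
    ... | inj₂ (inj₂ (inj₂ refl)) = ⊥-elim (c-opposite i eq)
    opposite-edge : ∀ i → Edge X (c i) (c (next (next i))) → Edge X x₀ x₂ ⊎ Edge X x₁ x₃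
    opposite-edge zero                   e = inj₁ e
    opposite-edge (suc zero)             e = inj₂ e
    opposite-edge (suc (suc zero))       e = inj₁ (Edge-sym e)
    opposite-edge (suc (suc (suc zero))) e = inj₂ (Edge-sym e)
    diagonal : HasChord X 4 c → Edge X x₀ x₂ ⊎ Edge X x₁ x₃
    diagonal (i , j , i≢j , ¬ij , ¬ji , e) with C₄-pairs i j
    ... | inj₁ i≡j                = ⊥-elim (i≢j i≡j)
    ... | inj₂ (inj₁ cn)          = ⊥-elim (¬ij cn)
    ... | inj₂ (inj₂ (inj₁ cn))   = ⊥-elim (¬ji cn)
    ... | inj₂ (inj₂ (inj₂ refl)) = opposite-edge i e

  maximal-clique-absorbs : ∀ {Ω w} → IsMaximalClique X Ω → (∀ u → Ω u → u ≢ w → Edge X u w) → Ω w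
  maximal-clique-absorbs {Ω} {w} (clique , maximal) adjacent =
    maximal (λ z → Ω z ⊎ z ≡ w) clique′ inj₁ (inj₂ refl)
    where
    clique′ : IsClique X (λ z → Ω z ⊎ z ≡ w)
    clique′ u v (inj₁ Ωu)   (inj₁ Ωv)   u≢v = clique u v Ωu Ωv u≢v
    clique′ u v (inj₁ Ωu)   (inj₂ refl) u≢v = adjacent u Ωu u≢v
    clique′ u v (inj₂ refl) (inj₁ Ωv)   u≢v = Edge-sym (adjacent v Ωv (u≢v ∘ sym))
    clique′ u v (inj₂ refl) (inj₂ refl) u≢v = ⊥-elim (u≢v refl)

  module _ (Y : SimpleGraph V) where

    IsCycle-mono : ∀ {l c} → X ⊑ Y → IsCycle X l c → IsCycle Y l c
    IsCycle-mono X⊑Y (c-injective , c-edge) = c-injective , λ i j → X⊑Y _ _ ∘ c-edge i j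

    chordal⇒ChordalOn : ∀ {P} → X ⊑ Y → Chordal Y → (∀ u v → P u → P v → Edge Y u v → Edge X u v) →
                        ChordalOn P
    chordal⇒ChordalOn X⊑Y chordal reflect l 4≤l c cyc inP with chordal l 4≤l c (IsCycle-mono X⊑Y cyc)
    ... | i , j , i≢j , ¬ij , ¬ji , e = i , j , i≢j , ¬ij , ¬ji , reflect _ _ (inP i) (inP j) e

comap : {A V : Set} → (A → V) → SimpleGraph V → SimpleGraph A
comap f X = record
  { adj     = λ a b → adj X (f a) (f b)
  ; adj-sym = λ a b → adj-sym X (f a) (f b)
  ; irrefl  = λ a → irrefl X (f a)
  }

module _ {A V : Set} {X : SimpleGraph V} {Y : SimpleGraph A} {f : A → V}
         (f-injective : Injective _≡_ _≡_ f)
         (f-edge : ∀ a b → Edge Y a b → Edge X (f a) (f b))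
         (f-edge⁻ : ∀ a b → Edge X (f a) (f b) → Edge Y a b) where

  ChordalOn-image⇒Chordal : ChordalOn X (λ w → ∃ λ a → f a ≡ w) → Chordal Y
  ChordalOn-image⇒Chordal chordal-on l 4≤l c (c-injective , c-edge)
    with chordal-on l 4≤l (f ∘ c) (c-injective ∘ f-injective , λ i j → f-edge _ _ ∘ c-edge i j)
                    (λ t → c t , refl)
  ... | i , j , i≢j , ¬ij , ¬ji , e = i , j , i≢j , ¬ij , ¬ji , f-edge⁻ _ _ e

  Chordal⇒ChordalOn-image : Chordal Y → ChordalOn X (λ w → ∃ λ a → f a ≡ w)
  Chordal⇒ChordalOn-image chordal l 4≤l c (c-injective , c-edge) in-image
    with chordal l 4≤l (proj₁ ∘ in-image) (c-injective ∘ lift , λ i j → f-edge⁻ _ _ ∘ lift-edge ∘ c-edge i j)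
    where
    lift : ∀ {i j} → proj₁ (in-image i) ≡ proj₁ (in-image j) → c i ≡ c j
    lift {i} {j} eq = trans (sym (proj₂ (in-image i))) (trans (cong f eq) (proj₂ (in-image j)))
    lift-edge : ∀ {i j} → Edge X (c i) (c j) → Edge X (f (proj₁ (in-image i))) (f (proj₁ (in-image j)))
    lift-edge {i} {j} = subst₂ (Edge X) (sym (proj₂ (in-image i))) (sym (proj₂ (in-image j)))
  ... | i , j , i≢j , ¬ij , ¬ji , e =
    i , j , i≢j , ¬ij , ¬ji , subst₂ (Edge X) (proj₂ (in-image i)) (proj₂ (in-image j)) (f-edge _ _ e)

module FilterEdges {V : Set} (X : SimpleGraph V) {Keep : V → V → Set}
                   (keep? : ∀ u v → Dec (Keep u v)) (keep-sym : ∀ u v → Keep u v → Keep v u) where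

  filtered : SimpleGraph V
  filtered = record
    { adj     = λ u v → adj X u v ∧ does (keep? u v)
    ; adj-sym = λ u v → cong₂ _∧_ (adj-sym X u v)
                          (does-⇔ (mk⇔ (keep-sym u v) (keep-sym v u)) (keep? u v) (keep? v u))
    ; irrefl  = λ u → cong (_∧ does (keep? u u)) (irrefl X u)
    }

  filtered⊑ : filtered ⊑ X
  filtered⊑ u v e with adj X u v
  ... | true  = refl
  ... | false = e

  Edge-filtered⇒Keep : ∀ u v → Edge filtered u v → Keep u v
  Edge-filtered⇒Keep u v e with adj X u v | keep? u v
  ... | true  | yes k = k
  ... | true  | no _  with () ← e
  ... | false | _     with () ← e

  Edge-filtered : ∀ u v → Edge X u v → Keep u v → Edge filtered u v
  Edge-filtered u v e k rewrite e with keep? u v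
  ... | yes _ = refl
  ... | no ¬k = ⊥-elim (¬k k)

module _ {V : Set} (X : SimpleGraph V) {A B : Pred V 0ℓ} (A? : Decidable A) (B? : Decidable B)
         (A-disjoint-B : ∀ u → A u → ¬ B u)
         (no-A-B-edge : ∀ u v → A u → B v → ¬ Edge X u v)
         (separator-clique : IsClique X (λ w → ¬ A w × ¬ B w)) where

  chordal-clique-separator : ChordalOn X (∁ B) → ChordalOn X (∁ A) → Chordal X
  chordal-clique-separator chordal-off-B chordal-off-A l 4≤l c cyc with any? (B? ∘ c) | any? (A? ∘ c)
  ... | no ¬∃B | _      = chordal-off-B l 4≤l c cyc (λ t Bt → ¬∃B (t , Bt))
  ... | yes _  | no ¬∃A = chordal-off-A l 4≤l c cyc (λ t At → ¬∃A (t , At))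
  chordal-clique-separator _ _ (suc n) _ c (c-injective , c-edge) | yes (tB , BtB) | yes (tA , AtA)
    with exit-point (A? ∘ c) AtA (λ AtB → A-disjoint-B _ AtB BtB)
       | exit-point (B? ∘ c) BtB (A-disjoint-B _ AtA)
  ... | u , Au , ¬Ap | w , Bw , ¬Bq =
    next u , next w , p≢q , ¬pq , ¬qp , separator-clique _ _ (¬Ap , ¬Bp) (¬Aq , ¬Bq) (p≢q ∘ c-injective)
    where
    ¬Bp : ¬ B (c (next u))
    ¬Bp Bp = no-A-B-edge _ _ Au Bp (c-edge u (next u) (cycNext-next u))
    ¬Aq : ¬ A (c (next w))
    ¬Aq Aq = no-A-B-edge _ _ Aq Bw (Edge-sym X (c-edge w (next w) (cycNext-next w)))
    p≢q : next u ≢ next w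
    p≢q eq = A-disjoint-B _ Au (subst (B ∘ c) (sym (next-injective eq)) Bw)
    ¬pq : ¬ CycNext (suc n) (next u) (next w)
    ¬pq cn = ¬Bp (subst (B ∘ c) (next-injective (cycNext⇒≡next cn)) Bw)
    ¬qp : ¬ CycNext (suc n) (next w) (next u)
    ¬qp cn = ¬Aq (subst (A ∘ c) (next-injective (cycNext⇒≡next cn)) Au)

-- Fans

module _ {V : Set} (X : SimpleGraph V) where

  -- x, p 0, …, p g is a cycle of X all of whose chords contain the apex x.
  record ApexedCycle (x : V) (p : ℕ → V) (g : ℕ) : Set where
    field
      rim-fresh     : ∀ {u} → u ≤ g → p u ≢ x
      rim-injective : ∀ {u v} → u ≤ g → v ≤ g → p u ≡ p v → u ≡ v
      rim-edge      : ∀ {u} → u < g → Edge X (p u) (p (suc u))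
      rim-induced   : ∀ {u v} → u ≤ g → v ≤ g → Edge X (p u) (p v) → suc u ≡ v ⊎ suc v ≡ u
      apex-first    : Edge X x (p 0)
      apex-last     : Edge X x (p g)

  module _ {x p g} (A : ApexedCycle x p g) where
    open ApexedCycle A

    apexed-IsCycle : IsCycle X (2 + g) (x ∷ p ∘ toℕ)
    apexed-IsCycle = c-injective , c-edge
      where
      c-injective : Injective _≡_ _≡_ (x ∷ p ∘ toℕ)
      c-injective {zero}  {zero}   _  = refl
      c-injective {zero}  {suc k}  eq = ⊥-elim (rim-fresh (toℕ≤pred[n] k) (sym eq))
      c-injective {suc k} {zero}   eq = ⊥-elim (rim-fresh (toℕ≤pred[n] k) eq)
      c-injective {suc k} {suc k′} eq =
        cong suc (toℕ-injective (rim-injective (toℕ≤pred[n] k) (toℕ≤pred[n] k′) eq))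
      c-edge : ∀ i j → CycNext (2 + g) i j → Edge X ((x ∷ p ∘ toℕ) i) ((x ∷ p ∘ toℕ) j)
      c-edge zero     (suc k)  (inj₁ eq)       = subst (Edge X x ∘ p) (sym (ℕ.suc-injective eq)) apex-first
      c-edge (suc k)  zero     (inj₂ (eq , _)) =
        Edge-sym X (subst (Edge X x ∘ p) (sym (ℕ.suc-injective eq)) apex-last)
      c-edge (suc k)  (suc k′) (inj₁ eq)       =
        subst (Edge X (p (toℕ k)) ∘ p) (sym (ℕ.suc-injective eq))
          (rim-edge (subst (_≤ g) (ℕ.suc-injective eq) (toℕ≤pred[n] k′)))
      c-edge zero     zero     (inj₁ ())
      c-edge zero     zero     (inj₂ (() , _))
      c-edge zero     (suc k)  (inj₂ (() , _))
      c-edge (suc k)  zero     (inj₁ ())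
      c-edge (suc k)  (suc k′) (inj₂ (_ , ()))

    apexed-chord : HasChord X (2 + g) (x ∷ p ∘ toℕ) → ∃ λ s → 0 < s × s < g × Edge X x (p s)
    apexed-chord (zero  , zero   , 0≢0 , _) = ⊥-elim (0≢0 refl)
    apexed-chord (zero  , suc k  , _ , ¬0k , ¬k0 , e) =
      toℕ k , ℕ.n≢0⇒n>0 (λ eq → ¬0k (inj₁ (cong suc eq)))
            , ℕ.≤∧≢⇒< (toℕ≤pred[n] k) (λ eq → ¬k0 (inj₂ (cong suc eq , refl))) , e
    apexed-chord (suc k , zero   , _ , ¬k0 , ¬0k , e) =
      toℕ k , ℕ.n≢0⇒n>0 (λ eq → ¬0k (inj₁ (cong suc eq)))
            , ℕ.≤∧≢⇒< (toℕ≤pred[n] k) (λ eq → ¬k0 (inj₂ (cong suc eq , refl))) , Edge-sym X e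
    apexed-chord (suc k , suc k′ , _ , ¬kk′ , ¬k′k , e)
      with rim-induced (toℕ≤pred[n] k) (toℕ≤pred[n] k′) e
    ... | inj₁ eq = ⊥-elim (¬kk′ (inj₁ (cong suc (sym eq))))
    ... | inj₂ eq = ⊥-elim (¬k′k (inj₁ (cong suc (sym eq))))

  ApexedCycle-prefix : ∀ {x p g s} → ApexedCycle x p g → s ≤ g → Edge X x (p s) → ApexedCycle x p s
  ApexedCycle-prefix A s≤g e = record
    { rim-fresh     = λ u≤s → rim-fresh (ℕ.≤-trans u≤s s≤g)
    ; rim-injective = λ u≤s v≤s → rim-injective (ℕ.≤-trans u≤s s≤g) (ℕ.≤-trans v≤s s≤g)
    ; rim-edge      = λ u<s → rim-edge (ℕ.<-≤-trans u<s s≤g)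
    ; rim-induced   = λ u≤s v≤s → rim-induced (ℕ.≤-trans u≤s s≤g) (ℕ.≤-trans v≤s s≤g)
    ; apex-first    = apex-first
    ; apex-last     = e
    }
    where open ApexedCycle A

  ApexedCycle-suffix : ∀ {x p} s {r} → ApexedCycle x p (s + r) → Edge X x (p s) →
                       ApexedCycle x (λ u → p (s + u)) r
  ApexedCycle-suffix {x} {p} s A e = record
    { rim-fresh     = rim-fresh ∘ shift
    ; rim-injective = λ u≤r v≤r → ℕ.+-cancelˡ-≡ s _ _ ∘ rim-injective (shift u≤r) (shift v≤r)
    ; rim-edge      = λ {u} u<r →
        subst (Edge X (p (s + u)) ∘ p) (sym (ℕ.+-suc s u)) (rim-edge (ℕ.+-monoʳ-< s u<r))
    ; rim-induced   = λ {u} {v} u≤r v≤r e′ → Sum.map (unshift u v) (unshift v u)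
                        (rim-induced (shift u≤r) (shift v≤r) e′)
    ; apex-first    = subst (Edge X x ∘ p) (sym (ℕ.+-identityʳ s)) e
    ; apex-last     = apex-last
    }
    where
    open ApexedCycle A
    shift : ∀ {u r} → u ≤ r → s + u ≤ s + r
    shift = ℕ.+-monoʳ-≤ s
    unshift : ∀ u v → suc (s + u) ≡ s + v → suc u ≡ v
    unshift u v eq = ℕ.+-cancelˡ-≡ s _ _ (trans (ℕ.+-suc s u) eq)

  -- A chord from x to p s splits the cycle into the apexed cycles over p 0 … p s and p s … p g.
  apexed-fan : Chordal X → ∀ {x} g {p} → ApexedCycle x p g → ∀ {u} → u ≤ g → Edge X x (p u)
  apexed-fan chordal {x} = <-rec _ fan
    where
    fan : ∀ g → (∀ {g′} → g′ < g → ∀ {p} → ApexedCycle x p g′ → ∀ {u} → u ≤ g′ → Edge X x (p u)) →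
          ∀ {p} → ApexedCycle x p g → ∀ {u} → u ≤ g → Edge X x (p u)
    fan g rec {p} A {u} u≤g with u ℕ.≟ 0 | u ℕ.≟ g
    ... | yes refl | _        = ApexedCycle.apex-first A
    ... | no _     | yes refl = ApexedCycle.apex-last A
    ... | no u≢0   | no u≢g
      with apexed-chord A (chordal (2 + g) (s≤s (s≤s 2≤g)) _ (apexed-IsCycle A))
      where
      2≤g : 2 ≤ g
      2≤g = ℕ.≤-trans (s≤s (ℕ.n≢0⇒n>0 u≢0)) (ℕ.≤∧≢⇒< u≤g u≢g)
    ... | s , 0<s , s<g , e with u ℕ.≤? s
    ...   | yes u≤s = rec s<g (ApexedCycle-prefix A (ℕ.<⇒≤ s<g) e) u≤s
    ...   | no u≰s with ℕ.m≤n⇒∃[o]m+o≡n (ℕ.<⇒≤ s<g) | ℕ.m≤n⇒∃[o]m+o≡n (ℕ.<⇒≤ (ℕ.≰⇒> u≰s))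
    ...     | r , refl | t , refl =
      rec (ℕ.m<n+m r 0<s) (ApexedCycle-suffix s A e) (ℕ.+-cancelˡ-≤ s t r u≤g)


-- Expansions

module _ {k : ℕ} {m : Fin k → ℕ} (G : SimpleGraph (Fin k)) (M : (i : Fin k) → SimpleGraph (Fin (m i))) where

  adj-Expansion-inside : ∀ {i} (a b : Fin (m i)) → adj (Expansion G M) (i , a) (i , b) ≡ adj (M i) a b
  adj-Expansion-inside {i} a b with i Fin.≟ i
  ... | yes refl = refl
  ... | no i≢i   = ⊥-elim (i≢i refl)

  adj-Expansion-across : ∀ {i j} (a : Fin (m i)) (b : Fin (m j)) → i ≢ j →
                         adj (Expansion G M) (i , a) (j , b) ≡ adj G i j
  adj-Expansion-across {i} {j} a b i≢j with i Fin.≟ j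
  ... | yes i≡j = ⊥-elim (i≢j i≡j)
  ... | no _    = refl

module AroundModule {k : ℕ} {m : Fin k → ℕ} (G : SimpleGraph (Fin k))
                    (M : (i : Fin k) → SimpleGraph (Fin (m i))) (i : Fin k) where

  private
    W : Set
    W = ExpVertex k m
    H : SimpleGraph W
    H = Expansion G M

  Module? : Decidable (Module {k} {m} i)
  Module? w = proj₁ w Fin.≟ i

  InN InR : Pred W 0ℓ
  InN (j , _) = j ≢ i × Edge G i j
  InR (j , _) = j ≢ i × ¬ Edge G i j

  InR? : Decidable InR
  InR? (j , _) = ¬? (j Fin.≟ i) ×-dec ¬? (Edge? G i j)

  classify : ∀ w → Module i w ⊎ InN w ⊎ InR w
  classify (j , _) with j Fin.≟ i | Edge? G i j
  ... | yes j≡i | _     = inj₁ j≡i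
  ... | no j≢i  | yes e = inj₂ (inj₁ (j≢i , e))
  ... | no j≢i  | no ¬e = inj₂ (inj₂ (j≢i , ¬e))

  separator⇒InN : ∀ w → ¬ Module i w × ¬ InR w → InN w
  separator⇒InN w (¬M , ¬R) with classify w
  ... | inj₁ Mw        = ⊥-elim (¬M Mw)
  ... | inj₂ (inj₁ Nw) = Nw
  ... | inj₂ (inj₂ Rw) = ⊥-elim (¬R Rw)

  InR⇒¬Module : ∀ w → InR w → ¬ Module i w
  InR⇒¬Module _ (j≢i , _) = j≢i

  Edge-Expansion-N : ∀ a {w} → InN w → Edge H (i , a) w
  Edge-Expansion-N a {j , b} (j≢i , e) = trans (adj-Expansion-across G M a b (j≢i ∘ sym)) e

  ¬Edge-Expansion-R : ∀ a {w} → InR w → ¬ Edge H (i , a) w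
  ¬Edge-Expansion-R a {j , b} (j≢i , ¬e) e = ¬e (trans (sym (adj-Expansion-across G M a b (j≢i ∘ sym))) e)

  Edge-Expansion-twins : ∀ a b {w} → ¬ Module i w → Edge H (i , a) w → Edge H (i , b) w
  Edge-Expansion-twins a b {j , c} j≢i e =
    trans (adj-Expansion-across G M b c (j≢i ∘ sym)) (trans (sym (adj-Expansion-across G M a c (j≢i ∘ sym))) e)

  Nbhd≐InN : Fin (m i) → Nbhd H (Module i) ≐ InN
  Nbhd≐InN a₀ = Nbhd⊆InN , InN⊆Nbhd
    where
    Nbhd⊆InN : ∀ {w} → Nbhd H (Module i) w → InN w
    Nbhd⊆InN {j , b} (((_ , a) , refl , e) , j≢i) =
      j≢i , trans (sym (adj-Expansion-across G M a b (j≢i ∘ sym))) e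
    InN⊆Nbhd : ∀ {w} → InN w → Nbhd H (Module i) w
    InN⊆Nbhd N = ((i , a₀) , refl , Edge-Expansion-N a₀ N) , proj₁ N

  V-vertex : Fin (m i) → W
  V-vertex a = i , a

  V-vertex-injective : Injective _≡_ _≡_ V-vertex
  V-vertex-injective refl = refl

  Module⇒image : ∀ {w} → Module i w → ∃ λ a → V-vertex a ≡ w
  Module⇒image {_ , a} refl = a , refl

  module InTriangulation (T : SimpleGraph W) (minimal-triangulation : MinimalTriangulation H T) where

    private
      H⊑T : H ⊑ T
      H⊑T = proj₁ minimal-triangulation
      T-chordal : Chordal T
      T-chordal = proj₁ (proj₂ minimal-triangulation)
      T-minimal : ∀ T′ → H ⊑ T′ → T′ ⊑ T → Chordal T′ → T ⊑ T′
      T-minimal = proj₂ (proj₂ minimal-triangulation)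

    V-complete-to-N : ∀ a {w} → InN w → Edge T (i , a) w
    V-complete-to-N a N = H⊑T _ _ (Edge-Expansion-N a N)

    ¬V-clique⇒N-clique : ¬ IsClique T (Module i) → IsClique T InN
    ¬V-clique⇒N-clique ¬V-clique u v Nu Nv u≢v with Edge? T u v
    ... | yes e  = e
    ... | no ¬e = ⊥-elim (¬V-clique V-clique)
      where
      V-clique : IsClique T (Module i)
      V-clique (_ , a) (_ , b) refl refl a≢b
        with chordal-square T T-chordal a≢b u≢v (V-complete-to-N a Nu) (Edge-sym T (V-complete-to-N b Nu))
                                                (V-complete-to-N b Nv) (Edge-sym T (V-complete-to-N a Nv))
      ... | inj₁ e  = e
      ... | inj₂ e′ = ⊥-elim (¬e e′)

    N-universal : IsClique T InN → ∀ {u v} → InN u → ¬ InR v → u ≢ v → Edge T u v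
    N-universal N-clique {u} {v} Nu ¬Rv u≢v with classify v
    ... | inj₁ refl      = Edge-sym T (V-complete-to-N _ Nu)
    ... | inj₂ (inj₁ Nv) = N-clique u v Nu Nv u≢v
    ... | inj₂ (inj₂ Rv) = ⊥-elim (¬Rv Rv)

    module WithoutVR where

      Keep : W → W → Set
      Keep u v = ¬ (Module i u × InR v) × ¬ (Module i v × InR u)

      keep? : ∀ u v → Dec (Keep u v)
      keep? u v = ¬? (Module? u ×-dec InR? v) ×-dec ¬? (Module? v ×-dec InR? u)

      keep-sym : ∀ u v → Keep u v → Keep v u
      keep-sym _ _ (k₁ , k₂) = k₂ , k₁

      open FilterEdges T keep? keep-sym public renaming (filtered to T∖VR; filtered⊑ to T∖VR⊑T)

      H⊑T∖VR : H ⊑ T∖VR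
      H⊑T∖VR u v e = Edge-filtered u v (H⊑T u v e) (no-VR u v e , no-VR v u (Edge-sym H {u} {v} e))
        where
        no-VR : ∀ u v → Edge H u v → ¬ (Module i u × InR v)
        no-VR (_ , a) v e (refl , Rv) = ¬Edge-Expansion-R a Rv e

      T∖VR-chordal : IsClique T InN → Chordal T∖VR
      T∖VR-chordal N-clique = chordal-clique-separator T∖VR Module? InR?
        (λ u Mu Ru → InR⇒¬Module u Ru Mu)
        (λ u v Mu Rv e → proj₁ (Edge-filtered⇒Keep u v e) (Mu , Rv))
        (λ u v Su Sv u≢v → Edge-filtered u v (N-clique u v (separator⇒InN u Su) (separator⇒InN v Sv) u≢v)
                                             (proj₂ Sv ∘ proj₂ , proj₂ Su ∘ proj₂))
        (chordal⇒ChordalOn T∖VR T T∖VR⊑T T-chordal λ u v ¬Ru ¬Rv e →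
           Edge-filtered u v e (¬Rv ∘ proj₂ , ¬Ru ∘ proj₂))
        (chordal⇒ChordalOn T∖VR T T∖VR⊑T T-chordal λ u v ¬Mu ¬Mv e →
           Edge-filtered u v e (¬Mu ∘ proj₁ , ¬Mv ∘ proj₁))

    N-clique⇒¬V-R-edge : IsClique T InN → ∀ u w → Module i u → InR w → ¬ Edge T u w
    N-clique⇒¬V-R-edge N-clique u w Mu Rw e =
      proj₁ (Edge-filtered⇒Keep u w (T-minimal T∖VR H⊑T∖VR T∖VR⊑T (T∖VR-chordal N-clique) u w e)) (Mu , Rw)
      where open WithoutVR

    CompleteToV : Pred W 0ℓ
    CompleteToV w = ∀ a → Edge T (i , a) w

    -- T without the edges joining V to an outside vertex that is not complete to V.
    module WithoutPartial where

      Keep : W → W → Set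
      Keep u v = (Module i u → ¬ Module i v → CompleteToV v) × (Module i v → ¬ Module i u → CompleteToV u)

      keep? : ∀ u v → Dec (Keep u v)
      keep? u v = (Module? u →-dec ¬? (Module? v) →-dec all? λ a → Edge? T (i , a) v)
            ×-dec (Module? v →-dec ¬? (Module? u) →-dec all? λ a → Edge? T (i , a) u)

      keep-sym : ∀ u v → Keep u v → Keep v u
      keep-sym _ _ (k₁ , k₂) = k₂ , k₁

      open FilterEdges T keep? keep-sym public renaming (filtered to T∖partial; filtered⊑ to T∖partial⊑T)

      Edge-T∖partial⇒CompleteToV : ∀ u v → Module i u → ¬ Module i v → Edge T∖partial u v → CompleteToV v
      Edge-T∖partial⇒CompleteToV u v Mu ¬Mv e = proj₁ (Edge-filtered⇒Keep u v e) Mu ¬Mv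

      CompleteToV⇒Edge-T∖partial : ∀ u v → Module i u → ¬ Module i v → CompleteToV v → Edge T∖partial u v
      CompleteToV⇒Edge-T∖partial (_ , a) v refl ¬Mv full =
        Edge-filtered _ v (full a) ((λ _ _ → full) , λ Mv → ⊥-elim (¬Mv Mv))

      Edge-T∖partial-inside : ∀ u v → Module i u → Module i v → Edge T u v → Edge T∖partial u v
      Edge-T∖partial-inside u v Mu Mv e =
        Edge-filtered u v e ((λ _ ¬Mv → ⊥-elim (¬Mv Mv)) , λ _ ¬Mu → ⊥-elim (¬Mu Mu))

      Edge-T∖partial-outside : ∀ u v → ¬ Module i u → ¬ Module i v → Edge T u v → Edge T∖partial u v
      Edge-T∖partial-outside u v ¬Mu ¬Mv e =
        Edge-filtered u v e ((λ Mu → ⊥-elim (¬Mu Mu)) , λ Mv → ⊥-elim (¬Mv Mv))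

      H⊑T∖partial : H ⊑ T∖partial
      H⊑T∖partial u v e = Edge-filtered u v (H⊑T u v e) (full u v e , full v u (Edge-sym H {u} {v} e))
        where
        full : ∀ u v → Edge H u v → Module i u → ¬ Module i v → CompleteToV v
        full (_ , a) v e refl ¬Mv b = H⊑T _ _ (Edge-Expansion-twins a b ¬Mv e)

      -- rim u is position u + 1, so the rim d ∘ rim is the cycle with d zero removed.
      module ChordlessThroughV (V-clique : IsClique T (Module i)) {n} {d : Fin (4 + n) → W}
                               (d-cycle : IsCycle T∖partial (4 + n) d)
                               (¬chord : ¬ HasChord T∖partial (4 + n) d) (M₀ : Module i (d zero)) where

        private
          d-injective : Injective _≡_ _≡_ d
          d-injective = proj₁ d-cycle
          d-edge : ∀ j j′ → CycNext (4 + n) j j′ → Edge T∖partial (d j) (d j′)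
          d-edge = proj₂ d-cycle

        rim : ℕ → Fin (4 + n)
        rim u = clamp (suc u)

        toℕ-rim : ∀ {u} → u ≤ 2 + n → toℕ (rim u) ≡ suc u
        toℕ-rim u≤ = toℕ-clamp (s≤s u≤)

        rim≢zero : ∀ {u} → u ≤ 2 + n → rim u ≢ zero
        rim≢zero u≤ eq = ℕ.1+n≢0 (trans (sym (toℕ-rim u≤)) (cong toℕ eq))

        rim-step : ∀ {u} → u < 2 + n → CycNext (4 + n) (rim u) (rim (suc u))
        rim-step u< = inj₁ (trans (toℕ-rim u<) (cong suc (sym (toℕ-rim (ℕ.<⇒≤ u<)))))

        rim-cycNext : ∀ {u v} → u ≤ 2 + n → v ≤ 2 + n → CycNext (4 + n) (rim u) (rim v) → suc u ≡ v
        rim-cycNext u≤ v≤ (inj₁ eq) =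
          sym (ℕ.suc-injective (trans (sym (toℕ-rim v≤)) (trans eq (cong suc (toℕ-rim u≤)))))
        rim-cycNext u≤ v≤ (inj₂ (_ , eq)) = ⊥-elim (ℕ.1+n≢0 (trans (sym (toℕ-rim v≤)) eq))

        ¬Edge-zero-inner : ∀ {u} → 0 < u → u < 2 + n → ¬ Edge T∖partial (d zero) (d (rim u))
        ¬Edge-zero-inner {u} 0<u u< e =
          ¬chord (zero , rim u , rim≢zero (ℕ.<⇒≤ u<) ∘ sym , proj₁ nonadj , proj₂ nonadj , e)
          where
          nonadj : ¬ CycNext (4 + n) zero (rim u) × ¬ CycNext (4 + n) (rim u) zero
          nonadj = nonadjacent-zero (subst (1 <_) (sym (toℕ-rim (ℕ.<⇒≤ u<))) (s≤s 0<u))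
                                    (subst (_< 3 + n) (sym (toℕ-rim (ℕ.<⇒≤ u<))) (s≤s u<))

        ¬Module-inner : ∀ {u} → 0 < u → u < 2 + n → ¬ Module i (d (rim u))
        ¬Module-inner 0<u u< Mu = ¬Edge-zero-inner 0<u u<
          (Edge-T∖partial-inside _ _ M₀ Mu (V-clique _ _ M₀ Mu (rim≢zero (ℕ.<⇒≤ u<) ∘ sym ∘ d-injective)))

        ¬CompleteToV-inner : ∀ {u} → 0 < u → u < 2 + n → ¬ CompleteToV (d (rim u))
        ¬CompleteToV-inner 0<u u< complete =
          ¬Edge-zero-inner 0<u u< (CompleteToV⇒Edge-T∖partial _ _ M₀ (¬Module-inner 0<u u<) complete)

        ¬Module-rim : ∀ {u} → u ≤ 2 + n → ¬ Module i (d (rim u))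
        ¬Module-rim {u} u≤ with u ℕ.≟ 0 | u ℕ.≟ 2 + n
        ... | yes refl | _ = λ M-first → ¬CompleteToV-inner {1} (s≤s z≤n) (s≤s (s≤s z≤n))
          (Edge-T∖partial⇒CompleteToV _ _ M-first (¬Module-inner (s≤s z≤n) (s≤s (s≤s z≤n)))
            (d-edge _ _ (rim-step (s≤s z≤n))))
        ... | no _ | yes refl = λ M-last → ¬CompleteToV-inner {1 + n} (s≤s z≤n) ℕ.≤-refl
          (Edge-T∖partial⇒CompleteToV _ _ M-last (¬Module-inner (s≤s z≤n) ℕ.≤-refl)
            (Edge-sym T∖partial {d (rim (1 + n))} {d (rim (2 + n))} (d-edge _ _ (rim-step ℕ.≤-refl))))
        ... | no u≢0 | no u≢last = ¬Module-inner (ℕ.n≢0⇒n>0 u≢0) (ℕ.≤∧≢⇒< u≤ u≢last)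

        rim-induced : ∀ {u v} → u ≤ 2 + n → v ≤ 2 + n → Edge T (d (rim u)) (d (rim v)) → suc u ≡ v ⊎ suc v ≡ u
        rim-induced {u} {v} u≤ v≤ e with cycNext? (rim u) (rim v) | cycNext? (rim v) (rim u)
        ... | yes cn | _      = inj₁ (rim-cycNext u≤ v≤ cn)
        ... | no _   | yes cn = inj₂ (rim-cycNext v≤ u≤ cn)
        ... | no ¬uv | no ¬vu = ⊥-elim (¬chord (rim u , rim v , Edge⇒≢ T e ∘ cong d , ¬uv , ¬vu ,
              Edge-T∖partial-outside _ _ (¬Module-rim u≤) (¬Module-rim v≤) e))

        apexed : ∀ a → ApexedCycle T (i , a) (d ∘ rim) (2 + n)
        apexed a = record
          { rim-fresh     = λ u≤ eq → ¬Module-rim u≤ (subst (Module i) (sym eq) refl)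
          ; rim-injective = λ u≤ v≤ eq →
              ℕ.suc-injective (trans (sym (toℕ-rim u≤)) (trans (cong toℕ (d-injective eq)) (toℕ-rim v≤)))
          ; rim-edge      = λ u< → T∖partial⊑T _ _ (d-edge _ _ (rim-step u<))
          ; rim-induced   = rim-induced
          ; apex-first    = Edge-T∖partial⇒CompleteToV _ _ M₀ (¬Module-rim z≤n)
              (d-edge zero (rim 0) (inj₁ (toℕ-rim z≤n))) a
          ; apex-last     = Edge-T∖partial⇒CompleteToV _ _ M₀ (¬Module-rim ℕ.≤-refl)
              (Edge-sym T∖partial {d (rim (2 + n))} {d zero} (d-edge _ _ (inj₂ (toℕ-rim ℕ.≤-refl , refl)))) a
          }

        impossible : ⊥
        impossible = ¬CompleteToV-inner {1} (s≤s z≤n) (s≤s (s≤s z≤n))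
          (λ a → apexed-fan T T-chordal (2 + n) (apexed a) (s≤s z≤n))

      T∖partial-chordal : IsClique T (Module i) → Chordal T∖partial
      T∖partial-chordal V-clique = no-chordless⇒chordal T∖partial no-chordless
        where
        no-chordless : ∀ {n} (c : Fin (4 + n) → W) → IsCycle T∖partial (4 + n) c →
                       ¬ HasChord T∖partial (4 + n) c → ⊥
        no-chordless {n} c cyc ¬chord with any? (Module? ∘ c)
        ... | no ¬∃M = ¬chord (chordal⇒ChordalOn T∖partial T T∖partial⊑T T-chordal Edge-T∖partial-outside
                                 (4 + n) (ℕ.m≤m+n 4 n) c cyc (λ t Mt → ¬∃M (t , Mt)))
        ... | yes (s , Ms) = ChordlessThroughV.impossible V-clique (IsCycle-rotate T∖partial s cyc)
                               (¬chord ∘ HasChord-rotate⁻ T∖partial s) (subst (Module i ∘ c) (sym (rotate-zero s)) Ms)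

    V-clique⇒twins : IsClique T (Module i) → ∀ a b w → ¬ Module i w → Edge T (i , a) w → Edge T (i , b) w
    V-clique⇒twins V-clique a b w ¬Mw e = Edge-T∖partial⇒CompleteToV _ w refl ¬Mw
      (T-minimal T∖partial H⊑T∖partial T∖partial⊑T (T∖partial-chordal V-clique) _ _ e) b
      where open WithoutPartial

    T↾V : SimpleGraph (Fin (m i))
    T↾V = comap V-vertex T

    M⊑T↾V : M i ⊑ T↾V
    M⊑T↾V a b e = H⊑T _ _ (trans (adj-Expansion-inside G M a b) e)

    T↾V-chordal : Chordal T↾V
    T↾V-chordal = ChordalOn-image⇒Chordal {X = T} {Y = T↾V} V-vertex-injective (λ _ _ e → e) (λ _ _ e → e)
      (λ l 4≤l c cyc _ → T-chordal l 4≤l c cyc)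

    module _ (S : SimpleGraph (Fin (m i))) where

      private
        adj-replace : W → W → Bool
        adj-replace (j , a) (j′ , b) with j Fin.≟ i | j′ Fin.≟ i
        ... | yes refl | yes refl = adj S a b
        ... | _        | _        = adj T (j , a) (j′ , b)

        adj-replace-sym : ∀ u v → adj-replace u v ≡ adj-replace v u
        adj-replace-sym (j , a) (j′ , b) with j Fin.≟ i | j′ Fin.≟ i
        ... | yes refl | yes refl = adj-sym S a b
        ... | yes refl | no _     = adj-sym T _ _
        ... | no _     | yes refl = adj-sym T _ _
        ... | no _     | no _     = adj-sym T _ _

        adj-replace-irrefl : ∀ u → adj-replace u u ≡ false
        adj-replace-irrefl (j , a) with j Fin.≟ i
        ... | yes refl = irrefl S a
        ... | no _     = irrefl T _

      replace-inside : SimpleGraph W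
      replace-inside = record { adj = adj-replace ; adj-sym = adj-replace-sym ; irrefl = adj-replace-irrefl }

      adj-replace-inside : ∀ a b → adj replace-inside (i , a) (i , b) ≡ adj S a b
      adj-replace-inside a b with i Fin.≟ i
      ... | yes refl = refl
      ... | no i≢i   = ⊥-elim (i≢i refl)

      adj-replace-outside : ∀ u v → ¬ (Module i u × Module i v) → adj replace-inside u v ≡ adj T u v
      adj-replace-outside (j , a) (j′ , b) ¬both with j Fin.≟ i | j′ Fin.≟ i
      ... | yes refl | yes refl = ⊥-elim (¬both (refl , refl))
      ... | yes refl | no _     = refl
      ... | no _     | yes refl = refl
      ... | no _     | no _     = refl

    module Reglued (N-clique : IsClique T InN) (S : SimpleGraph (Fin (m i)))
                   (M⊑S : M i ⊑ S) (S⊑T↾V : S ⊑ T↾V) (S-chordal : Chordal S) where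

      T′ : SimpleGraph W
      T′ = replace-inside S

      Edge-T′-outside : ∀ u v → ¬ (Module i u × Module i v) → Edge T u v → Edge T′ u v
      Edge-T′-outside u v ¬both = trans (adj-replace-outside S u v ¬both)

      H⊑T′ : H ⊑ T′
      H⊑T′ u v e with Module? u ×-dec Module? v
      H⊑T′ (_ , a) (_ , b) e | yes (refl , refl) =
        trans (adj-replace-inside S a b) (M⊑S a b (trans (sym (adj-Expansion-inside G M a b)) e))
      H⊑T′ u v e | no ¬both = Edge-T′-outside u v ¬both (H⊑T u v e)

      T′⊑T : T′ ⊑ T
      T′⊑T u v e with Module? u ×-dec Module? v
      T′⊑T (_ , a) (_ , b) e | yes (refl , refl) = S⊑T↾V a b (trans (sym (adj-replace-inside S a b)) e)
      T′⊑T u v e | no ¬both = trans (sym (adj-replace-outside S u v ¬both)) e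

      T′-chordal-off-R : ChordalOn T′ (∁ InR)
      T′-chordal-off-R l 4≤l c cyc@(c-injective , _) ¬R with any? (λ t → ¬? (Module? (c t)))
      ... | yes (s , ¬Ms) = universal⇒HasChord T′ 4≤l cyc s λ t t≢s →
        Edge-T′-outside (c s) (c t) (¬Ms ∘ proj₁)
          (N-universal N-clique (separator⇒InN (c s) (¬Ms , ¬R s)) (¬R t) (t≢s ∘ sym ∘ c-injective))
      ... | no ¬∃ = Chordal⇒ChordalOn-image {X = T′} {Y = S} V-vertex-injective
        (λ a b → trans (adj-replace-inside S a b)) (λ a b → trans (sym (adj-replace-inside S a b)))
        S-chordal l 4≤l c cyc (λ t → Module⇒image (decidable-stable (Module? (c t)) (λ ¬M → ¬∃ (t , ¬M))))

      T′-chordal : Chordal T′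
      T′-chordal = chordal-clique-separator T′ Module? InR?
        (λ u Mu Ru → InR⇒¬Module u Ru Mu)
        (λ u v Mu Rv e → N-clique⇒¬V-R-edge N-clique u v Mu Rv
          (trans (sym (adj-replace-outside S u v (InR⇒¬Module v Rv ∘ proj₂))) e))
        (λ u v Su Sv u≢v → Edge-T′-outside u v (proj₁ Su ∘ proj₁)
          (N-clique u v (separator⇒InN u Su) (separator⇒InN v Sv) u≢v))
        T′-chordal-off-R
        (chordal⇒ChordalOn T′ T T′⊑T T-chordal λ u v ¬Mu _ → Edge-T′-outside u v (¬Mu ∘ proj₁))

    T↾V-minimal : IsClique T InN → ∀ S → M i ⊑ S → S ⊑ T↾V → Chordal S → T↾V ⊑ S
    T↾V-minimal N-clique S M⊑S S⊑T↾V S-chordal a b e =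
      trans (sym (adj-replace-inside S a b)) (T-minimal T′ H⊑T′ T′⊑T T′-chordal _ _ e)
      where open Reglued N-clique S M⊑S S⊑T↾V S-chordal

    module AtMaximalClique (Ω : Pred W 0ℓ) (Ω-maximal : IsMaximalClique T Ω) {a₀} (Ωa₀ : Ω (i , a₀))
                           (V⊈Ω : ¬ (∀ a → Ω (i , a))) where

      private
        Ω-clique : IsClique T Ω
        Ω-clique = proj₁ Ω-maximal

      ¬V-clique : ¬ IsClique T (Module i)
      ¬V-clique V-clique = V⊈Ω λ a → maximal-clique-absorbs T Ω-maximal (adjacent a)
        where
        adjacent : ∀ a u → Ω u → u ≢ (i , a) → Edge T u (i , a)
        adjacent a u Ωu u≢ with Module? u
        ... | yes Mu = V-clique u (i , a) Mu refl u≢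
        ... | no ¬Mu = Edge-sym T (V-clique⇒twins V-clique a₀ a u ¬Mu
                         (Ω-clique (i , a₀) u Ωa₀ Ωu (¬Mu ∘ sym ∘ cong proj₁)))

      N-clique : IsClique T InN
      N-clique = ¬V-clique⇒N-clique ¬V-clique

      Ω∖V⊆N : ∀ {w} → Ω w × ¬ Module i w → InN w
      Ω∖V⊆N {w} (Ωw , ¬Mw) = separator⇒InN w (¬Mw , λ Rw →
        N-clique⇒¬V-R-edge N-clique (i , a₀) w refl Rw
          (Ω-clique (i , a₀) w Ωa₀ Ωw (¬Mw ∘ sym ∘ cong proj₁)))

      N⊆Ω∖V : ∀ {w} → InN w → Ω w × ¬ Module i w
      N⊆Ω∖V {w} Nw = maximal-clique-absorbs T Ω-maximal adjacent , proj₁ Nw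
        where
        adjacent : ∀ u → Ω u → u ≢ w → Edge T u w
        adjacent u Ωu u≢w with Module? u
        adjacent (_ , a) Ωu u≢w | yes refl = V-complete-to-N a Nw
        adjacent u       Ωu u≢w | no ¬Mu   = N-clique u w (Ω∖V⊆N (Ωu , ¬Mu)) Nw u≢w

      Ω∖V≐N : (λ w → Ω w × ¬ Module i w) ≐ InN
      Ω∖V≐N = Ω∖V⊆N , N⊆Ω∖V

      Ω↾V-maximal : IsMaximalClique T↾V (λ a → Ω (i , a))
      Ω↾V-maximal = clique , maximal
        where
        clique : IsClique T↾V (λ a → Ω (i , a))
        clique a b Ωa Ωb a≢b = Ω-clique _ _ Ωa Ωb (a≢b ∘ V-vertex-injective)
        maximal : ∀ Ω′ → IsClique T↾V Ω′ → (λ a → Ω (i , a)) ⊆ Ω′ → Ω′ ⊆ (λ a → Ω (i , a))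
        maximal Ω′ Ω′-clique Ω↾V⊆Ω′ Ω′a = proj₂ Ω-maximal Ω″ Ω″-clique Ω⊆Ω″ (inj₂ (_ , refl , Ω′a))
          where
          Ω″ : Pred W 0ℓ
          Ω″ w = (Ω w × ¬ Module i w) ⊎ (∃ λ a → V-vertex a ≡ w × Ω′ a)
          Ω⊆Ω″ : Ω ⊆ Ω″
          Ω⊆Ω″ {w} Ωw with Module? w
          Ω⊆Ω″ {_ , a} Ωw | yes refl = inj₂ (a , refl , Ω↾V⊆Ω′ Ωw)
          Ω⊆Ω″ {w}     Ωw | no ¬Mw   = inj₁ (Ωw , ¬Mw)
          Ω″-clique : IsClique T Ω″
          Ω″-clique u v (inj₁ (Ωu , _)) (inj₁ (Ωv , _)) u≢v = Ω-clique u v Ωu Ωv u≢v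
          Ω″-clique u _ (inj₁ Ωu∖V) (inj₂ (b , refl , _)) _ = Edge-sym T (V-complete-to-N b (Ω∖V⊆N Ωu∖V))
          Ω″-clique _ v (inj₂ (a , refl , _)) (inj₁ Ωv∖V) _ = V-complete-to-N a (Ω∖V⊆N Ωv∖V)
          Ω″-clique _ _ (inj₂ (a , refl , Ω′a)) (inj₂ (b , refl , Ω′b)) u≢v =
            Ω′-clique a b Ω′a Ω′b (u≢v ∘ cong V-vertex)

lemma7 : (k : ℕ) (m : Fin k → ℕ) (G : SimpleGraph (Fin k))
         (M : (i : Fin k) → SimpleGraph (Fin (m i)))
         (Ω : Pred (ExpVertex k m) 0ℓ) (i : Fin k) →
         IsPMC (Expansion G M) Ω →
         (∃ λ a → Ω (i , a)) →
         ¬ (∀ a → Ω (i , a)) →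
         IsPMC (M i) (λ a → Ω (i , a)) ×
         ((λ w → Ω w × ¬ Module i w) ≐ Nbhd (Expansion G M) (Module i))
lemma7 k m G M Ω i (T , triangulation , Ω-maximal) (a₀ , Ωa₀) V⊈Ω =
  (T↾V , (M⊑T↾V , T↾V-chordal , T↾V-minimal N-clique) , Ω↾V-maximal) ,
  ≐-trans Ω∖V≐N (≐-sym (Nbhd≐InN a₀))
  where
  open AroundModule G M i
  open InTriangulation T triangulation
  open AtMaximalClique Ω Ω-maximal Ωa₀ V⊈Ω
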